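{- Let $n_1\geq n_2\geq n_3\ge 2$ be integers and $N = n_1 + n_2 + n_3$. Then \[ \mu_{\rm t}(K_{n_1}\,\square\, K_{n_2}\,\square\, K_{n_3}) = \begin{cases} N - 4, & n_3 = 2, \\ N - 5, & n_3 = 3, \\ N - 6, & n_3\ge 4. \end{cases} \]
   Context: For a connected graph $G$ and $X\subseteq V(G)$, two vertices $x,y$ are $X$-visible if there is a shortest $x,y$-path none of whose internal vertices lies in $X$. $X$ is a total mutual-visibility set if every two vertices of $V(G)$ are $X$-visible. $\mu_{\rm t}(G)$ is the maximum cardinality of a total mutual-visibility set of $G$. $G\,\square\, H$ denotes the Cartesian product of graphs: vertex set $V(G)\times V(H)$, with $(g,h)\sim(g',h')$ iff either $gg'\in E(G)$ and $h=h'$, or $g=g'$ and $hh'\in E(H)$. $K_n$ is the complete graph on $n$ vertices. -}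

module Defs where

open import Data.Nat using (ℕ; zero; suc; _≤_)
open import Data.Fin using (Fin)
open import Data.List using (List; []; _∷_; length)
open import Data.List.Relation.Unary.All using (All)
open import Data.List.Relation.Unary.Unique.Propositional using (Unique)
open import Data.List.Membership.Propositional using (_∈_; _∉_)
open import Data.Product using (_×_; Σ; _,_)
open import Data.Sum using (_⊎_)
open import Relation.Binary.PropositionalEquality using (_≡_; _≢_)

record Graph : Set₁ where
  field
    V   : Set
    Adj : V → V → Set
open Graph public

K : ℕ → Graph
K n = record { V = Fin n ; Adj = λ i j → i ≢ j }

_□_ : Graph → Graph → Graph
G □ H = record
  { V   = V G × V H
  ; Adj = λ { (g , h) (g′ , h′) →
              (Adj G g g′ × h ≡ h′) ⊎ (g ≡ g′ × Adj H h h′) } }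
infixl 6 _□_

module _ (G : Graph) where
  data Walk : V G → V G → Set where
    []  : ∀ {x} → Walk x x
    _∷_ : ∀ {x y z} → Adj G x y → Walk y z → Walk x z

  walkLength : ∀ {x y} → Walk x y → ℕ
  walkLength []      = 0
  walkLength (_ ∷ w) = suc (walkLength w)

  internal : ∀ {x y} → Walk x y → List (V G)
  internal []                 = []
  internal (_ ∷ [])           = []
  internal (_∷_ {y = y} _ (e ∷ w)) = y ∷ internal (e ∷ w)

  IsShortest : ∀ {x y} → Walk x y → Set
  IsShortest {x} {y} w = ∀ (w′ : Walk x y) → walkLength w ≤ walkLength w′

  Visible : List (V G) → V G → V G → Set
  Visible X x y = Σ (Walk x y) λ w → IsShortest w × All (λ v → v ∉ X) (internal w)

  -- X is a total mutual-visibility set (X a set of vertices: duplicate-free list)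
  IsTotalMutVis : List (V G) → Set
  IsTotalMutVis X = Unique X × (∀ x y → Visible X x y)

  IsMuT : ℕ → Set
  IsMuT k = (Σ (List (V G)) λ X → IsTotalMutVis X × length X ≡ k)
          × (∀ X → IsTotalMutVis X → length X ≤ k)

{-# OPTIONS --safe #-}
-- Write vertices as coordinate triples. If two vertices of a total mutual-visibility set X
-- differ in exactly two coordinates, the two other corners of their square are at distance
-- two and have only these two vertices as common neighbours, so they are not X-visible.
-- Hence two vertices of X coincide, lie on a common line, or differ in every coordinate.
-- All lines joining a vertex x of X to the rest of X are then parallel, to a direction
-- dir x, and x ↦ (dir x , x_{dir x}) embeds X into the N pairs (direction, value). The image
-- misses every pair of an unused direction and, for used directions d ≠ d′ witnessed by
-- p and p′, the pair (d′ , p_{d′}); so |X| ≤ N − min (n_e + n_f , n_e + 2 , 6).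
-- Conversely {(a,0,0) : a ≥ 1} ∪ {(0,b,1) : b ≥ 1} and
-- {(a,0,0) : a ≥ 2} ∪ {(0,b,1) : b ≥ 2} ∪ {(1,1,c) : c ≥ 2} are total mutual-visibility
-- sets: between any two vertices, some shortest path correcting one coordinate at a time,
-- in a suitable order, avoids the set. Whether an order works depends only on which
-- coordinates are 0, 1 or ≥ 2 and which of them agree, so finitely many cases remain,
-- and these are decided by evaluation.
module Submission where

open import Defs
open import Data.Nat using (ℕ; suc; _≤_; _+_; _∸_; z≤n; s≤s)
open import Data.Nat.Properties
open import Algebra.Properties.CommutativeSemigroup +-commutativeSemigroup
  using (x∙yz≈xz∙y; x∙yz≈yx∙z; x∙yz≈zx∙y; x∙yz≈yz∙x; x∙yz≈zy∙x)
open import Data.Fin using (Fin; zero; suc; toℕ)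
open import Data.Fin.Properties using (toℕ-injective) renaming (_≟_ to _≟ᶠ_)
open import Data.Product using (_×_; Σ; _,_; proj₁; proj₂)
open import Data.Sum using (_⊎_; inj₁; inj₂)
open import Data.Empty using (⊥-elim)
open import Data.List using (List; []; _∷_; length; map; _++_; tabulate)
open import Data.List.Properties using (length-removeAt′; length-++; length-map; length-tabulate)
open import Data.List.Relation.Unary.All as All using (All; []; _∷_)
open import Data.List.Relation.Unary.All.Properties as All using ()
open import Data.List.Relation.Unary.Any using (Any; here; there; index; any?)
open import Data.List.Relation.Unary.AllPairs using ([]; _∷_)
open import Data.List.Relation.Unary.Unique.Propositional using (Unique)
open import Data.List.Relation.Unary.Unique.Propositional.Properties using (++⁺; tabulate⁺)
open import Data.List.Membership.Propositional using (_∈_; _∉_; _─_; find; lose)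
open import Data.List.Membership.Propositional.Properties
  using (∈-map⁻; ∈-++⁻; ∈-++⁺ˡ; ∈-++⁺ʳ; ∈-tabulate⁺; ∈-tabulate⁻)
open import Data.List.Relation.Binary.Subset.Propositional using (_⊆_)
open import Relation.Binary.PropositionalEquality
open import Data.Unit using (tt)
open import Relation.Nullary using (¬_; Dec; yes; no)
open import Relation.Nullary.Decidable using (¬?; _×-dec_; _→-dec_; isYes; toWitness)
open import Data.Bool using (Bool; true; false; T; not; _∧_; _∨_; if_then_else_)
open import Data.Bool.Properties using (T?; T-∧; T-∨; T-not-≡)
open import Function using (_∘_)
open import Function.Bundles using (Equivalence)
open Equivalence using (to)
open import Data.Nat.Tactic.RingSolver using (solve-∀)

module _ {G : Graph} where

  infixr 5 _++ʷ_
  _++ʷ_ : ∀ {x y z} → Walk G x y → Walk G y z → Walk G x z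
  []      ++ʷ w = w
  (e ∷ v) ++ʷ w = e ∷ (v ++ʷ w)

  length-++ʷ : ∀ {x y z} (v : Walk G x y) (w : Walk G y z) →
    walkLength G (v ++ʷ w) ≡ walkLength G v + walkLength G w
  length-++ʷ []      w = refl
  length-++ʷ (e ∷ v) w = cong suc (length-++ʷ v w)

  All-internal-++ʷ : ∀ {P : V G → Set} {x m z} (v : Walk G x m) (w : Walk G m z) →
    All P (internal G v) → All P (internal G w) →
    P m ⊎ walkLength G v ≡ 0 ⊎ walkLength G w ≡ 0 → All P (internal G (v ++ʷ w))
  All-internal-++ʷ []           w       _         Pw _                  = Pw
  All-internal-++ʷ (e ∷ [])     []      _         _  _                  = []
  All-internal-++ʷ (e ∷ [])     (f ∷ w) _         Pw (inj₁ Pm)          = Pm ∷ Pw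
  All-internal-++ʷ (e ∷ [])     (f ∷ w) _         _  (inj₂ (inj₁ ()))
  All-internal-++ʷ (e ∷ [])     (f ∷ w) _         _  (inj₂ (inj₂ ()))
  All-internal-++ʷ (e ∷ e′ ∷ v) w       (Py ∷ Pv) Pw (inj₁ Pm)          =
    Py ∷ All-internal-++ʷ (e′ ∷ v) w Pv Pw (inj₁ Pm)
  All-internal-++ʷ (e ∷ e′ ∷ v) w       _         _  (inj₂ (inj₁ ()))
  All-internal-++ʷ (e ∷ e′ ∷ v) w       (Py ∷ Pv) Pw (inj₂ (inj₂ w≡0))  =
    Py ∷ All-internal-++ʷ (e′ ∷ v) w Pv Pw (inj₂ (inj₂ w≡0))

  ¬Visible-at-distance-two : ∀ {X u v x} → u ≢ v → ¬ Adj G u v → Adj G u x → Adj G x v →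
    (∀ m → Adj G u m → Adj G m v → m ∈ X) → ¬ Visible G X u v
  ¬Visible-at-distance-two u≢v _ _ _ _ ([] , _) = u≢v refl
  ¬Visible-at-distance-two _ ¬u~v _ _ _ (e ∷ [] , _) = ¬u~v e
  ¬Visible-at-distance-two _ _ _ _ blocked (_∷_ {y = m} e (f ∷ []) , _ , m∉X ∷ []) =
    m∉X (blocked m e f)
  ¬Visible-at-distance-two _ _ u~x x~v _ (_ ∷ _ ∷ _ ∷ _ , shortest , _)
    with shortest (u~x ∷ x~v ∷ [])
  ... | s≤s (s≤s ())

IsMuT-∸ : ∀ {G : Graph} {X : List (V G)} {g N} → IsTotalMutVis G X → length X + g ≡ N →
  (∀ Y → IsTotalMutVis G Y → length Y + g ≤ N) → IsMuT G (N ∸ g)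
IsMuT-∸ {X = X} {g} X-tmv length≡ bound =
  (X , X-tmv , trans (sym (m+n∸n≡m (length X) g)) (cong (_∸ g) length≡)) ,
  λ Y Y-tmv → m+n≤o⇒m≤o∸n (length Y) (bound Y Y-tmv)

module _ {A : Set} where

  ∈-─ : ∀ {x z : A} {ys} → z ∈ ys → z ≢ x → (x∈ys : x ∈ ys) → z ∈ ys ─ x∈ys
  ∈-─ (here refl) z≢x (here refl) = ⊥-elim (z≢x refl)
  ∈-─ (there z∈)  _   (here refl) = z∈
  ∈-─ (here refl) _   (there _)   = here refl
  ∈-─ (there z∈)  z≢x (there x∈)  = there (∈-─ z∈ z≢x x∈)

  Unique⇒length-≤ : ∀ {xs ys : List A} → Unique xs → xs ⊆ ys → length xs ≤ length ys
  Unique⇒length-≤ {[]}     _                _     = z≤n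
  Unique⇒length-≤ {x ∷ xs} {ys} (x∉xs ∷ xs!) xs⊆ys = begin
    suc (length xs)           ≤⟨ s≤s (Unique⇒length-≤ xs! xs⊆ys─x) ⟩
    suc (length (ys ─ x∈ys))  ≡⟨ length-removeAt′ ys (index x∈ys) ⟨
    length ys                 ∎
    where
    open ≤-Reasoning
    x∈ys : x ∈ ys
    x∈ys = xs⊆ys (here refl)
    xs⊆ys─x : xs ⊆ ys ─ x∈ys
    xs⊆ys─x z∈xs = ∈-─ (xs⊆ys (there z∈xs)) (λ z≡x → All.lookup x∉xs z∈xs (sym z≡x)) x∈ys

  Unique-map⁺-on : ∀ {B : Set} (f : A → B) {xs} →
    (∀ {x y} → x ∈ xs → y ∈ xs → f x ≡ f y → x ≡ y) → Unique xs → Unique (map f xs)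
  Unique-map⁺-on f         _   []           = []
  Unique-map⁺-on f {x ∷ xs} inj (x∉xs ∷ xs!) =
    All.map⁺ (All.tabulate λ y∈ fx≡fy → All.lookup x∉xs y∈ (inj (here refl) (there y∈) fx≡fy))
    ∷ Unique-map⁺-on f (λ x∈ y∈ → inj (there x∈) (there y∈)) xs!

Loopless : Graph → Set
Loopless G = ∀ {v} → ¬ Adj G v v

K-loopless : ∀ n → Loopless (K n)
K-loopless n v≢v = v≢v refl

module _ {G H : Graph} where

  □-corner-¬Adj : ∀ {g g′ h h′} → g ≢ g′ → h ≢ h′ → ¬ Adj (G □ H) (g , h′) (g′ , h)
  □-corner-¬Adj _     h≢h′ (inj₁ (_ , h′≡h)) = h≢h′ (sym h′≡h)
  □-corner-¬Adj g≢g′ _    (inj₂ (g≡g′ , _)) = g≢g′ g≡g′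

  □-corner-common-neighbour : ∀ {g g′ h h′ m} → g ≢ g′ → h ≢ h′ →
    Adj (G □ H) (g , h′) m → Adj (G □ H) m (g′ , h) → m ≡ (g , h) ⊎ m ≡ (g′ , h′)
  □-corner-common-neighbour _     h≢h′ (inj₁ (_ , refl)) (inj₁ (_ , refl)) = ⊥-elim (h≢h′ refl)
  □-corner-common-neighbour _     _    (inj₁ (_ , refl)) (inj₂ (refl , _)) = inj₂ refl
  □-corner-common-neighbour _     _    (inj₂ (refl , _)) (inj₁ (_ , refl)) = inj₁ refl
  □-corner-common-neighbour g≢g′ _    (inj₂ (refl , _)) (inj₂ (refl , _)) = ⊥-elim (g≢g′ refl)

  □-layer-common-neighbour : Loopless H → ∀ {g g′ h} (m : V (G □ H)) → g ≢ g′ →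
    Adj (G □ H) (g , h) m → Adj (G □ H) m (g′ , h) →
    Σ (V G) λ k → m ≡ (k , h) × Adj G g k × Adj G k g′
  □-layer-common-neighbour _    (k , _) _     (inj₁ (g~k , refl)) (inj₁ (k~g′ , refl)) = k , refl , g~k , k~g′
  □-layer-common-neighbour loop (k , _) _     (inj₁ (_ , refl))   (inj₂ (_ , h~h))    = ⊥-elim (loop h~h)
  □-layer-common-neighbour loop (k , _) _     (inj₂ (refl , h~h)) (inj₁ (_ , refl))   = ⊥-elim (loop h~h)
  □-layer-common-neighbour _    (k , _) g≢g′ (inj₂ (refl , _))   (inj₂ (refl , _))   = ⊥-elim (g≢g′ refl)

  □-square-¬Visible : ∀ {X g g′ h h′} → Adj G g g′ → Adj H h′ h → g ≢ g′ → h ≢ h′ →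
    (g , h) ∈ X → (g′ , h′) ∈ X → ¬ Visible (G □ H) X (g , h′) (g′ , h)
  □-square-¬Visible {X} {g} {g′} {h} {h′} g~g′ h′~h g≢g′ h≢h′ x∈X y∈X =
    ¬Visible-at-distance-two {G = G □ H} (λ u≡v → g≢g′ (cong proj₁ u≡v)) (□-corner-¬Adj g≢g′ h≢h′)
      (inj₂ (refl , h′~h)) (inj₁ (g~g′ , refl)) blocked
    where
    blocked : ∀ m → Adj (G □ H) (g , h′) m → Adj (G □ H) m (g′ , h) → m ∈ X
    blocked m u~m m~v with □-corner-common-neighbour g≢g′ h≢h′ u~m m~v
    ... | inj₁ refl = x∈X
    ... | inj₂ refl = y∈X

  □-layer-¬Visible : Loopless H → ∀ {X g g′ k h} → g ≢ g′ → ¬ Adj G g g′ → Adj G g k → Adj G k g′ →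
    (∀ m → Adj G g m → Adj G m g′ → (m , h) ∈ X) → ¬ Visible (G □ H) X (g , h) (g′ , h)
  □-layer-¬Visible loop {X} {g} {g′} {k} {h} g≢g′ ¬g~g′ g~k k~g′ blocked =
    ¬Visible-at-distance-two {G = G □ H} (λ u≡v → g≢g′ (cong proj₁ u≡v)) ¬adjacent
      (inj₁ (g~k , refl)) (inj₁ (k~g′ , refl)) lifted
    where
    ¬adjacent : ¬ Adj (G □ H) (g , h) (g′ , h)
    ¬adjacent (inj₁ (g~g′ , _)) = ¬g~g′ g~g′
    ¬adjacent (inj₂ (g≡g′ , _)) = g≢g′ g≡g′
    lifted : ∀ m → Adj (G □ H) (g , h) m → Adj (G □ H) m (g′ , h) → m ∈ X
    lifted m u~m m~v with □-layer-common-neighbour loop m g≢g′ u~m m~v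
    ... | k′ , refl , g~k′ , k′~g′ = blocked k′ g~k′ k′~g′

  projˡ : ∀ {p q} → Walk (G □ H) p q → Walk G (proj₁ p) (proj₁ q)
  projˡ []                    = []
  projˡ (inj₁ (e , _) ∷ w)    = e ∷ projˡ w
  projˡ (inj₂ (refl , _) ∷ w) = projˡ w

  projʳ : ∀ {p q} → Walk (G □ H) p q → Walk H (proj₂ p) (proj₂ q)
  projʳ []                    = []
  projʳ (inj₁ (_ , refl) ∷ w) = projʳ w
  projʳ (inj₂ (_ , e) ∷ w)    = e ∷ projʳ w

  walkLength-□ : ∀ {p q} (w : Walk (G □ H) p q) →
    walkLength (G □ H) w ≡ walkLength G (projˡ w) + walkLength H (projʳ w)
  walkLength-□ []                    = refl
  walkLength-□ (inj₁ (_ , refl) ∷ w) = cong suc (walkLength-□ w)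
  walkLength-□ (inj₂ (refl , _) ∷ w) =
    trans (cong suc (walkLength-□ w)) (sym (+-suc (walkLength G (projˡ w)) (walkLength H (projʳ w))))

mismatch : ∀ {A : Set} → Dec A → ℕ
mismatch (yes _) = 0
mismatch (no _)  = 1

mismatch-≡0 : ∀ {A : Set} {A? : Dec A} → A → mismatch A? ≡ 0
mismatch-≡0 {A? = yes _} _ = refl
mismatch-≡0 {A? = no ¬a} a = ⊥-elim (¬a a)

module _ {G : Graph} {A : Set} (f : A → V G) (adjacent : ∀ {a a′} → a ≢ a′ → Adj G (f a) (f a′)) where

  stepAlong : ∀ {a a′} → Dec (a ≡ a′) → Walk G (f a) (f a′)
  stepAlong (yes refl) = []
  stepAlong (no a≢a′)  = adjacent a≢a′ ∷ []

  length-stepAlong : ∀ {a a′} (a≟a′ : Dec (a ≡ a′)) → walkLength G (stepAlong a≟a′) ≡ mismatch a≟a′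
  length-stepAlong (yes refl) = refl
  length-stepAlong (no _)     = refl

  All-internal-stepAlong : ∀ {P : V G → Set} {a a′} (a≟a′ : Dec (a ≡ a′)) → All P (internal G (stepAlong a≟a′))
  All-internal-stepAlong (yes refl) = []
  All-internal-stepAlong (no _)     = []

mismatch-≤-walkLength : ∀ {n} {i j : Fin n} (w : Walk (K n) i j) → mismatch (i ≟ᶠ j) ≤ walkLength (K n) w
mismatch-≤-walkLength []      = ≤-reflexive (mismatch-≡0 refl)
mismatch-≤-walkLength {i = i} {j} (_ ∷ w) with i ≟ᶠ j
... | yes _ = z≤n
... | no _  = s≤s z≤n

data Dir : Set where
  d₁ d₂ d₃ : Dir

_≟ᵈ_ : (d e : Dir) → Dec (d ≡ e)
d₁ ≟ᵈ d₁ = yes refl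
d₂ ≟ᵈ d₂ = yes refl
d₃ ≟ᵈ d₃ = yes refl
d₁ ≟ᵈ d₂ = no λ ()
d₁ ≟ᵈ d₃ = no λ ()
d₂ ≟ᵈ d₁ = no λ ()
d₂ ≟ᵈ d₃ = no λ ()
d₃ ≟ᵈ d₁ = no λ ()
d₃ ≟ᵈ d₂ = no λ ()

all-Dir? : {P : Dir → Set} → (∀ d → Dec (P d)) → Dec (∀ d → P d)
all-Dir? P? with P? d₁ | P? d₂ | P? d₃
... | yes p₁ | yes p₂ | yes p₃ = yes λ { d₁ → p₁ ; d₂ → p₂ ; d₃ → p₃ }
... | no ¬p₁ | _      | _      = no λ p → ¬p₁ (p d₁)
... | yes _  | no ¬p₂ | _      = no λ p → ¬p₂ (p d₂)
... | yes _  | yes _  | no ¬p₃ = no λ p → ¬p₃ (p d₃)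

data Route : Set where
  r₁₂₃ r₁₃₂ r₂₁₃ r₂₃₁ r₃₁₂ r₃₂₁ : Route

first second third : Route → Dir
first r₁₂₃ = d₁
first r₁₃₂ = d₁
first r₂₁₃ = d₂
first r₂₃₁ = d₂
first r₃₁₂ = d₃
first r₃₂₁ = d₃
second r₁₂₃ = d₂
second r₁₃₂ = d₃
second r₂₁₃ = d₁
second r₂₃₁ = d₃
second r₃₁₂ = d₁
second r₃₂₁ = d₂
third r₁₂₃ = d₃
third r₁₃₂ = d₂
third r₂₁₃ = d₃
third r₂₃₁ = d₁
third r₃₁₂ = d₂
third r₃₂₁ = d₁

allRoutes : List Route
allRoutes = r₁₂₃ ∷ r₁₃₂ ∷ r₂₁₃ ∷ r₂₃₁ ∷ r₃₁₂ ∷ r₃₂₁ ∷ []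

sum-route : ∀ r (f : Dir → ℕ) → f (first r) + (f (second r) + f (third r)) ≡ f d₁ + f d₂ + f d₃
sum-route r₁₂₃ f = sym (+-assoc (f d₁) (f d₂) (f d₃))
sum-route r₁₃₂ f = x∙yz≈xz∙y (f d₁) (f d₃) (f d₂)
sum-route r₂₁₃ f = x∙yz≈yx∙z (f d₂) (f d₁) (f d₃)
sum-route r₂₃₁ f = x∙yz≈zx∙y (f d₂) (f d₃) (f d₁)
sum-route r₃₁₂ f = x∙yz≈yz∙x (f d₃) (f d₁) (f d₂)
sum-route r₃₂₁ f = x∙yz≈zy∙x (f d₃) (f d₂) (f d₁)

data Class : Set where
  c₀ c₁ c₂ : Class

cls : ∀ {n} → Fin n → Class
cls zero          = c₀
cls (suc zero)    = c₁
cls (suc (suc _)) = c₂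

CoordPair : Set
CoordPair = Class × Class × Bool

pairOf : ∀ {n} → Fin n → Fin n → CoordPair
pairOf i j = cls i , cls j , isYes (i ≟ᶠ j)

coordPairs : List CoordPair
coordPairs = (c₀ , c₀ , true) ∷ (c₀ , c₁ , false) ∷ (c₀ , c₂ , false)
           ∷ (c₁ , c₀ , false) ∷ (c₁ , c₁ , true) ∷ (c₁ , c₂ , false)
           ∷ (c₂ , c₀ , false) ∷ (c₂ , c₁ , false) ∷ (c₂ , c₂ , true) ∷ (c₂ , c₂ , false) ∷ []

pairOf∈coordPairs : ∀ {n} (i j : Fin n) → pairOf i j ∈ coordPairs
pairOf∈coordPairs zero          zero          = here refl
pairOf∈coordPairs zero          (suc zero)    = there (here refl)
pairOf∈coordPairs zero          (suc (suc _)) = there (there (here refl))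
pairOf∈coordPairs (suc zero)    zero          = there (there (there (here refl)))
pairOf∈coordPairs (suc zero)    (suc zero)    = there (there (there (there (here refl))))
pairOf∈coordPairs (suc zero)    (suc (suc _)) = there (there (there (there (there (here refl)))))
pairOf∈coordPairs (suc (suc _)) zero          = there (there (there (there (there (there (here refl))))))
pairOf∈coordPairs (suc (suc _)) (suc zero)    = there (there (there (there (there (there (there (here refl)))))))
pairOf∈coordPairs (suc (suc i)) (suc (suc j)) with isYes (suc (suc i) ≟ᶠ suc (suc j))
... | true  = there (there (there (there (there (there (there (there (here refl))))))))
... | false = there (there (there (there (there (there (there (there (there (here refl)))))))))

ClassPattern : Set
ClassPattern = Class → Class → Class → Bool

-- Hamming.routeClear evaluated on coordinate pairs: at a stop of the route, the coordinates
-- already corrected carry the class of the target (see Hamming.routeClear-inPattern).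
routeClearᶜ : ClassPattern → Route → CoordPair → CoordPair → CoordPair → Bool
routeClearᶜ π r s₁ s₂ s₃ =
    (agree (first r) ∨ (agree (second r) ∧ agree (third r)) ∨ not (inπAfter λ d → isYes (d ≟ᵈ first r)))
  ∧ (agree (second r) ∨ agree (third r)
     ∨ not (inπAfter λ d → isYes (d ≟ᵈ first r) ∨ isYes (d ≟ᵈ second r)))
  where
  pair : Dir → CoordPair
  pair d₁ = s₁
  pair d₂ = s₂
  pair d₃ = s₃
  agree : Dir → Bool
  agree d = proj₂ (proj₂ (pair d))
  inπAfter : (Dir → Bool) → Bool
  inπAfter moved = π (classAfter d₁) (classAfter d₂) (classAfter d₃)
    where
    classAfter : Dir → Class
    classAfter d = if moved d then proj₁ (proj₂ (pair d)) else proj₁ (pair d)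

Check : ClassPattern → Set
Check π = All (λ s₁ → All (λ s₂ → All (λ s₃ → Any (λ r → T (routeClearᶜ π r s₁ s₂ s₃)) allRoutes)
            coordPairs) coordPairs) coordPairs

check? : ∀ π → Dec (Check π)
check? π = All.all? (λ s₁ → All.all? (λ s₂ → All.all? (λ s₃ → any? (λ r → T? (routeClearᶜ π r s₁ s₂ s₃))
             allRoutes) coordPairs) coordPairs) coordPairs

module Hamming (n₁ n₂ n₃ : ℕ) where

  Grid : Graph
  Grid = K n₁ □ K n₂ □ K n₃

  Vertex : Set
  Vertex = V Grid

  size : Dir → ℕ
  size d₁ = n₁
  size d₂ = n₂
  size d₃ = n₃

  coord : (d : Dir) → Vertex → Fin (size d)
  coord d₁ ((a , _) , _) = a
  coord d₂ ((_ , b) , _) = b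
  coord d₃ ((_ , _) , c) = c

  vertex-ext : ∀ {x y} → (∀ d → coord d x ≡ coord d y) → x ≡ y
  vertex-ext same-coords with same-coords d₁ | same-coords d₂ | same-coords d₃
  ... | refl | refl | refl = refl

  Line : Dir → Vertex → Vertex → Set
  Line d x y = coord d x ≢ coord d y × (∀ g → g ≢ d → coord g x ≡ coord g y)

  Plane : Dir → Dir → Vertex → Vertex → Set
  Plane d e x y = d ≢ e × coord d x ≢ coord d y × coord e x ≢ coord e y
                × (∀ g → g ≢ d → g ≢ e → coord g x ≡ coord g y)

  Apart : Vertex → Vertex → Set
  Apart x y = ∀ d → coord d x ≢ coord d y

  data Position (x y : Vertex) : Set where
    same  : x ≡ y → Position x y
    line  : ∀ d → Line d x y → Position x y
    plane : ∀ d e → Plane d e x y → Position x y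
    apart : Apart x y → Position x y

  position : ∀ x y → Position x y
  position x y with coord d₁ x ≟ᶠ coord d₁ y | coord d₂ x ≟ᶠ coord d₂ y | coord d₃ x ≟ᶠ coord d₃ y
  ... | yes e₁ | yes e₂ | yes e₃ = same (vertex-ext λ { d₁ → e₁ ; d₂ → e₂ ; d₃ → e₃ })
  ... | no ¬e₁ | yes e₂ | yes e₃ = line d₁ (¬e₁ , λ { d₁ g≢ → ⊥-elim (g≢ refl) ; d₂ _ → e₂ ; d₃ _ → e₃ })
  ... | yes e₁ | no ¬e₂ | yes e₃ = line d₂ (¬e₂ , λ { d₂ g≢ → ⊥-elim (g≢ refl) ; d₁ _ → e₁ ; d₃ _ → e₃ })
  ... | yes e₁ | yes e₂ | no ¬e₃ = line d₃ (¬e₃ , λ { d₃ g≢ → ⊥-elim (g≢ refl) ; d₁ _ → e₁ ; d₂ _ → e₂ })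
  ... | no ¬e₁ | no ¬e₂ | yes e₃ = plane d₁ d₂ ((λ ()) , ¬e₁ , ¬e₂ ,
          λ { d₁ g≢ _ → ⊥-elim (g≢ refl) ; d₂ _ g≢ → ⊥-elim (g≢ refl) ; d₃ _ _ → e₃ })
  ... | no ¬e₁ | yes e₂ | no ¬e₃ = plane d₁ d₃ ((λ ()) , ¬e₁ , ¬e₃ ,
          λ { d₁ g≢ _ → ⊥-elim (g≢ refl) ; d₃ _ g≢ → ⊥-elim (g≢ refl) ; d₂ _ _ → e₂ })
  ... | yes e₁ | no ¬e₂ | no ¬e₃ = plane d₂ d₃ ((λ ()) , ¬e₂ , ¬e₃ ,
          λ { d₂ g≢ _ → ⊥-elim (g≢ refl) ; d₃ _ g≢ → ⊥-elim (g≢ refl) ; d₁ _ _ → e₁ })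
  ... | no ¬e₁ | no ¬e₂ | no ¬e₃ = apart λ { d₁ → ¬e₁ ; d₂ → ¬e₂ ; d₃ → ¬e₃ }

  Plane-sym : ∀ {d e x y} → Plane d e x y → Plane e d x y
  Plane-sym (d≢e , ≢d , ≢e , agree) = (λ e≡d → d≢e (sym e≡d)) , ≢e , ≢d , λ g g≢e g≢d → agree g g≢d g≢e

  module _ {X : List Vertex} (vis : ∀ u v → Visible Grid X u v) where

    ¬Plane₁₂ : ∀ {x y} → x ∈ X → y ∈ X → ¬ Plane d₁ d₂ x y
    ¬Plane₁₂ {(a , b) , c} {(a′ , b′) , c′} x∈X y∈X (_ , a≢a′ , b≢b′ , agree)
      with agree d₃ (λ ()) (λ ())
    ... | refl =
      □-layer-¬Visible {G = K n₁ □ K n₂} {H = K n₃} (K-loopless n₃)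
        (λ u≡v → a≢a′ (cong proj₁ u≡v)) (□-corner-¬Adj {G = K n₁} {H = K n₂} a≢a′ b≢b′)
        (inj₂ (refl , λ b′≡b → b≢b′ (sym b′≡b))) (inj₁ (a≢a′ , refl)) blocked (vis _ _)
      where
      blocked : ∀ m → Adj (K n₁ □ K n₂) (a , b′) m → Adj (K n₁ □ K n₂) m (a′ , b) → (m , c) ∈ X
      blocked m u~m m~v with □-corner-common-neighbour {G = K n₁} {H = K n₂} a≢a′ b≢b′ u~m m~v
      ... | inj₁ refl = x∈X
      ... | inj₂ refl = y∈X

    ¬Plane₁₃ : ∀ {x y} → x ∈ X → y ∈ X → ¬ Plane d₁ d₃ x y
    ¬Plane₁₃ {(a , b) , c} {(a′ , b′) , c′} x∈X y∈X (_ , a≢a′ , c≢c′ , agree)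
      with agree d₂ (λ ()) (λ ())
    ... | refl =
      □-square-¬Visible {G = K n₁ □ K n₂} {H = K n₃} (inj₁ (a≢a′ , refl)) (λ c′≡c → c≢c′ (sym c′≡c))
        (λ g≡g′ → a≢a′ (cong proj₁ g≡g′)) c≢c′ x∈X y∈X (vis _ _)

    ¬Plane₂₃ : ∀ {x y} → x ∈ X → y ∈ X → ¬ Plane d₂ d₃ x y
    ¬Plane₂₃ {(a , b) , c} {(a′ , b′) , c′} x∈X y∈X (_ , b≢b′ , c≢c′ , agree)
      with agree d₁ (λ ()) (λ ())
    ... | refl =
      □-square-¬Visible {G = K n₁ □ K n₂} {H = K n₃} (inj₂ (refl , b≢b′)) (λ c′≡c → c≢c′ (sym c′≡c))
        (λ g≡g′ → b≢b′ (cong proj₂ g≡g′)) c≢c′ x∈X y∈X (vis _ _)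

    ¬Plane : ∀ {d e x y} → x ∈ X → y ∈ X → ¬ Plane d e x y
    ¬Plane {d₁} {d₂} x∈X y∈X p = ¬Plane₁₂ x∈X y∈X p
    ¬Plane {d₁} {d₃} x∈X y∈X p = ¬Plane₁₃ x∈X y∈X p
    ¬Plane {d₂} {d₃} x∈X y∈X p = ¬Plane₂₃ x∈X y∈X p
    ¬Plane {d₂} {d₁} x∈X y∈X p = ¬Plane₁₂ x∈X y∈X (Plane-sym p)
    ¬Plane {d₃} {d₁} x∈X y∈X p = ¬Plane₁₃ x∈X y∈X (Plane-sym p)
    ¬Plane {d₃} {d₂} x∈X y∈X p = ¬Plane₂₃ x∈X y∈X (Plane-sym p)
    ¬Plane {d₁} {d₁} _   _   (d≢e , _) = d≢e refl
    ¬Plane {d₂} {d₂} _   _   (d≢e , _) = d≢e refl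
    ¬Plane {d₃} {d₃} _   _   (d≢e , _) = d≢e refl

  Line-sym : ∀ {d x y} → Line d x y → Line d y x
  Line-sym (x≢y , agree) = (λ y≡x → x≢y (sym y≡x)) , λ g g≢d → sym (agree g g≢d)

  line-line⇒Plane : ∀ {d e x y z} → Line d x y → Line e x z → d ≢ e → Plane d e y z
  line-line⇒Plane {d} {e} (x≢y , agree-xy) (x≢z , agree-xz) d≢e =
    d≢e ,
    (λ y≡z → x≢y (trans (agree-xz d d≢e) (sym y≡z))) ,
    (λ y≡z → x≢z (trans (agree-xy e (λ e≡d → d≢e (sym e≡d))) y≡z)) ,
    λ g g≢d g≢e → trans (sym (agree-xy g g≢d)) (agree-xz g g≢e)

  line? : ∀ d x y → Dec (Line d x y)
  line? d x y = ¬? (coord d x ≟ᶠ coord d y)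
          ×-dec all-Dir? (λ g → ¬? (g ≟ᵈ d) →-dec (coord g x ≟ᶠ coord g y))

  -- A slot (d , i) stands for the value i < size d of coordinate d.
  Slot : Set
  Slot = Dir × ℕ

  slotAt : Dir → Vertex → Slot
  slotAt d x = d , toℕ (coord d x)

  slotsOf : Dir → List Slot
  slotsOf d = tabulate {n = size d} λ i → d , toℕ i

  allSlots : List Slot
  allSlots = (slotsOf d₁ ++ slotsOf d₂) ++ slotsOf d₃

  slotsOf⊆allSlots : ∀ d → slotsOf d ⊆ allSlots
  slotsOf⊆allSlots d₁ = ∈-++⁺ˡ ∘ ∈-++⁺ˡ
  slotsOf⊆allSlots d₂ = ∈-++⁺ˡ ∘ ∈-++⁺ʳ (slotsOf d₁)
  slotsOf⊆allSlots d₃ = ∈-++⁺ʳ (slotsOf d₁ ++ slotsOf d₂)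

  slotAt∈allSlots : ∀ d x → slotAt d x ∈ allSlots
  slotAt∈allSlots d x = slotsOf⊆allSlots d (∈-tabulate⁺ (coord d x))

  slotsOf-dir : ∀ {d s} → s ∈ slotsOf d → proj₁ s ≡ d
  slotsOf-dir {d} s∈ = cong proj₁ (proj₂ (∈-tabulate⁻ {f = λ (i : Fin (size d)) → d , toℕ i} s∈))

  slotsOf-unique : ∀ d → Unique (slotsOf d)
  slotsOf-unique d = tabulate⁺ λ eq → toℕ-injective (cong proj₂ eq)

  length-slotsOf : ∀ d → length (slotsOf d) ≡ size d
  length-slotsOf d = length-tabulate _

  length-allSlots : length allSlots ≡ n₁ + n₂ + n₃
  length-allSlots = begin
    length allSlots
      ≡⟨ length-++ (slotsOf d₁ ++ slotsOf d₂) ⟩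
    length (slotsOf d₁ ++ slotsOf d₂) + length (slotsOf d₃)
      ≡⟨ cong (_+ length (slotsOf d₃)) (length-++ (slotsOf d₁)) ⟩
    length (slotsOf d₁) + length (slotsOf d₂) + length (slotsOf d₃)
      ≡⟨ cong₂ _+_ (cong₂ _+_ (length-slotsOf d₁) (length-slotsOf d₂)) (length-slotsOf d₃) ⟩
    n₁ + n₂ + n₃ ∎
    where open ≡-Reasoning

  module Counting {X : List Vertex} (X-unique : Unique X)
                  (X-¬Plane : ∀ {d e x y} → x ∈ X → y ∈ X → ¬ Plane d e x y) where

    lines-parallel : ∀ {d e x y z} → y ∈ X → z ∈ X → Line d x y → Line e x z → d ≡ e
    lines-parallel {d} {e} y∈X z∈X xy xz with d ≟ᵈ e
    ... | yes d≡e = d≡e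
    ... | no d≢e  = ⊥-elim (X-¬Plane y∈X z∈X (line-line⇒Plane xy xz d≢e))

    dir : Vertex → Dir
    dir x with any? (line? d₂ x) X | any? (line? d₃ x) X
    ... | yes _ | _     = d₂
    ... | no _  | yes _ = d₃
    ... | no _  | no _  = d₁

    dir-line : ∀ {d x y} → y ∈ X → Line d x y → dir x ≡ d
    dir-line {d} {x} y∈X xy with any? (line? d₂ x) X | any? (line? d₃ x) X
    ... | yes l₂ | _ = let _ , z∈X , xz = find l₂ in sym (lines-parallel y∈X z∈X xy xz)
    ... | no _   | yes l₃ = let _ , z∈X , xz = find l₃ in sym (lines-parallel y∈X z∈X xy xz)
    dir-line {d₁} y∈X xy | no _   | no _   = refl
    dir-line {d₂} y∈X xy | no ¬l₂ | no _   = ⊥-elim (¬l₂ (lose y∈X xy))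
    dir-line {d₃} y∈X xy | no _   | no ¬l₃ = ⊥-elim (¬l₃ (lose y∈X xy))

    dir-agree : ∀ {d x y} → x ∈ X → y ∈ X → coord d x ≡ coord d y → dir x ≡ dir y
    dir-agree {d} {x} {y} x∈X y∈X agree with position x y
    ... | same refl     = refl
    ... | line _ xy     = trans (dir-line y∈X xy) (sym (dir-line x∈X (Line-sym xy)))
    ... | plane _ _ xy  = ⊥-elim (X-¬Plane x∈X y∈X xy)
    ... | apart xy      = ⊥-elim (xy d agree)

    slot : Vertex → Slot
    slot x = slotAt (dir x) x

    slot≡slotAt⇒coord≡ : ∀ {x y e} → slot x ≡ slotAt e y → coord e x ≡ coord e y
    slot≡slotAt⇒coord≡ {x} slot≡ with dir x | slot≡
    ... | d | eq with cong proj₁ eq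
    ... | refl = toℕ-injective (cong proj₂ eq)

    slot-injective : ∀ {x y} → x ∈ X → y ∈ X → slot x ≡ slot y → x ≡ y
    slot-injective {x} {y} x∈X y∈X slot≡ with position x y
    ... | same x≡y     = x≡y
    ... | line d xy    = ⊥-elim (proj₁ xy (subst (λ e → coord e x ≡ coord e y) (dir-line x∈X (Line-sym xy))
                                             (slot≡slotAt⇒coord≡ slot≡)))
    ... | plane _ _ xy = ⊥-elim (X-¬Plane x∈X y∈X xy)
    ... | apart xy     = ⊥-elim (xy (dir y) (slot≡slotAt⇒coord≡ slot≡))

    Free : Slot → Set
    Free s = s ∈ allSlots × (∀ {x} → x ∈ X → slot x ≢ s)

    length-+-free-≤ : ∀ {M} → Unique M → All Free M → length X + length M ≤ n₁ + n₂ + n₃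
    length-+-free-≤ {M} M-unique M-free = begin
      length X + length M             ≡⟨ cong (_+ length M) (length-map slot X) ⟨
      length (map slot X) + length M  ≡⟨ length-++ (map slot X) ⟨
      length (map slot X ++ M)        ≤⟨ Unique⇒length-≤ occupied∪M-unique occupied∪M⊆allSlots ⟩
      length allSlots                 ≡⟨ length-allSlots ⟩
      n₁ + n₂ + n₃                    ∎
      where
      open ≤-Reasoning
      occupied∪M-unique : Unique (map slot X ++ M)
      occupied∪M-unique = ++⁺ (Unique-map⁺-on slot slot-injective X-unique) M-unique λ (s∈ , s∈M) →
        let x , x∈X , s≡slot = ∈-map⁻ slot s∈ in proj₂ (All.lookup M-free s∈M) x∈X (sym s≡slot)
      occupied∪M⊆allSlots : map slot X ++ M ⊆ allSlots
      occupied∪M⊆allSlots s∈ with ∈-++⁻ (map slot X) s∈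
      ... | inj₂ s∈M = proj₁ (All.lookup M-free s∈M)
      ... | inj₁ s∈occupied with ∈-map⁻ slot s∈occupied
      ...   | x , _ , refl = slotAt∈allSlots (dir x) x

    slotAt-free : ∀ {p e} → p ∈ X → e ≢ dir p → Free (slotAt e p)
    slotAt-free {p} {e} p∈X e≢dir-p = slotAt∈allSlots e p , λ {x} x∈X slot≡ →
      e≢dir-p (trans (sym (cong proj₁ slot≡)) (dir-agree x∈X p∈X (slot≡slotAt⇒coord≡ slot≡)))

    slotAt-distinct : ∀ {p q e} → p ∈ X → q ∈ X → dir p ≢ dir q → slotAt e p ≢ slotAt e q
    slotAt-distinct p∈X q∈X dir-p≢dir-q eq = dir-p≢dir-q (dir-agree p∈X q∈X (toℕ-injective (cong proj₂ eq)))

    dirs-≢ : ∀ {p q d e} → dir p ≡ d → dir q ≡ e → d ≢ e → dir p ≢ dir q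
    dirs-≢ dir-p dir-q d≢e eq = d≢e (trans (sym dir-p) (trans eq dir-q))

    Unused : Dir → Set
    Unused e = ∀ {x} → x ∈ X → dir x ≢ e

    slotsOf-free : ∀ {e} → Unused e → All Free (slotsOf e)
    slotsOf-free {e} unused = All.tabulate λ s∈ →
      slotsOf⊆allSlots e s∈ , λ x∈X slot≡ → unused x∈X (trans (cong proj₁ slot≡) (slotsOf-dir s∈))

    two-unused : ∀ {e f} → e ≢ f → Unused e → Unused f →
      length X + (size e + size f) ≤ n₁ + n₂ + n₃
    two-unused {e} {f} e≢f unused-e unused-f =
      subst (λ k → length X + k ≤ n₁ + n₂ + n₃)
        (trans (length-++ (slotsOf e)) (cong₂ _+_ (length-slotsOf e) (length-slotsOf f)))
        (length-+-free-≤ (++⁺ (slotsOf-unique e) (slotsOf-unique f) disjoint)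
                         (All.++⁺ (slotsOf-free unused-e) (slotsOf-free unused-f)))
      where
      disjoint : ∀ {s} → ¬ (s ∈ slotsOf e × s ∈ slotsOf f)
      disjoint (s∈e , s∈f) = e≢f (trans (sym (slotsOf-dir s∈e)) (slotsOf-dir s∈f))

    one-unused : ∀ {e p p′} → p ∈ X → p′ ∈ X → dir p ≢ dir p′ → Unused e →
      length X + (size e + 2) ≤ n₁ + n₂ + n₃
    one-unused {e} {p} {p′} p∈X p′∈X dir-p≢dir-p′ unused =
      subst (λ k → length X + k ≤ n₁ + n₂ + n₃)
        (trans (length-++ (slotsOf e)) (cong (_+ 2) (length-slotsOf e)))
        (length-+-free-≤ (++⁺ (slotsOf-unique e) ((distinct ∷ []) ∷ [] ∷ []) disjoint)
                         (All.++⁺ (slotsOf-free unused)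
                                  (slotAt-free p∈X (λ eq → dir-p≢dir-p′ (sym eq))
                                   ∷ slotAt-free p′∈X dir-p≢dir-p′ ∷ [])))
      where
      distinct : slotAt (dir p′) p ≢ slotAt (dir p) p′
      distinct eq = dir-p≢dir-p′ (sym (cong proj₁ eq))
      disjoint : ∀ {s} → ¬ (s ∈ slotsOf e × s ∈ slotAt (dir p′) p ∷ slotAt (dir p) p′ ∷ [])
      disjoint (s∈e , here refl)         = unused p′∈X (slotsOf-dir s∈e)
      disjoint (s∈e , there (here refl)) = unused p∈X (slotsOf-dir s∈e)

    none-unused : ∀ {p₁ p₂ p₃} → p₁ ∈ X → p₂ ∈ X → p₃ ∈ X → dir p₁ ≡ d₁ → dir p₂ ≡ d₂ → dir p₃ ≡ d₃ →
      length X + 6 ≤ n₁ + n₂ + n₃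
    none-unused {p₁} {p₂} {p₃} p₁∈X p₂∈X p₃∈X dir-p₁ dir-p₂ dir-p₃ = length-+-free-≤ M-unique M-free
      where
      free : ∀ {p d e} → p ∈ X → dir p ≡ d → e ≢ d → Free (slotAt e p)
      free p∈X dir-p e≢d = slotAt-free p∈X λ eq → e≢d (trans eq dir-p)
      M : List Slot
      M = slotAt d₂ p₁ ∷ slotAt d₃ p₁ ∷ slotAt d₁ p₂ ∷ slotAt d₃ p₂ ∷ slotAt d₁ p₃ ∷ slotAt d₂ p₃ ∷ []
      M-unique : Unique M
      M-unique = ((λ ()) ∷ (λ ()) ∷ (λ ()) ∷ (λ ()) ∷ slotAt-distinct p₁∈X p₃∈X (dirs-≢ dir-p₁ dir-p₃ λ ()) ∷ [])
               ∷ ((λ ()) ∷ slotAt-distinct p₁∈X p₂∈X (dirs-≢ dir-p₁ dir-p₂ λ ()) ∷ (λ ()) ∷ (λ ()) ∷ [])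
               ∷ ((λ ()) ∷ slotAt-distinct p₂∈X p₃∈X (dirs-≢ dir-p₂ dir-p₃ λ ()) ∷ (λ ()) ∷ [])
               ∷ ((λ ()) ∷ (λ ()) ∷ [])
               ∷ ((λ ()) ∷ [])
               ∷ [] ∷ []
      M-free : All Free M
      M-free = free p₁∈X dir-p₁ (λ ()) ∷ free p₁∈X dir-p₁ (λ ()) ∷ free p₂∈X dir-p₂ (λ ())
             ∷ free p₂∈X dir-p₂ (λ ()) ∷ free p₃∈X dir-p₃ (λ ()) ∷ free p₃∈X dir-p₃ (λ ()) ∷ []

    unused : ∀ {e} → ¬ Any (λ x → dir x ≡ e) X → Unused e
    unused ¬used x∈X dir-x≡e = ¬used (lose x∈X dir-x≡e)

    weaken : ∀ {g a} → g ≤ a → length X + a ≤ n₁ + n₂ + n₃ → length X + g ≤ n₁ + n₂ + n₃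
    weaken g≤a = ≤-trans (+-monoʳ-≤ (length X) g≤a)

    length-bound : ∀ {k g} → (∀ d → k ≤ size d) → g ≤ k + k → g ≤ k + 2 → g ≤ 6 →
      length X + g ≤ n₁ + n₂ + n₃
    length-bound {k} {g} k≤size g≤k+k g≤k+2 g≤6
      with any? (λ x → dir x ≟ᵈ d₁) X | any? (λ x → dir x ≟ᵈ d₂) X | any? (λ x → dir x ≟ᵈ d₃) X
    ... | yes u₁ | yes u₂ | yes u₃ =
      let _ , p₁∈X , dir-p₁ = find u₁ ; _ , p₂∈X , dir-p₂ = find u₂ ; _ , p₃∈X , dir-p₃ = find u₃
      in weaken g≤6 (none-unused p₁∈X p₂∈X p₃∈X dir-p₁ dir-p₂ dir-p₃)
    ... | yes u₁ | yes u₂ | no ¬u₃ =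
      let _ , p₁∈X , dir-p₁ = find u₁ ; _ , p₂∈X , dir-p₂ = find u₂
      in weaken (≤-trans g≤k+2 (+-monoˡ-≤ 2 (k≤size d₃)))
                (one-unused p₁∈X p₂∈X (dirs-≢ dir-p₁ dir-p₂ λ ()) (unused ¬u₃))
    ... | yes u₁ | no ¬u₂ | yes u₃ =
      let _ , p₁∈X , dir-p₁ = find u₁ ; _ , p₃∈X , dir-p₃ = find u₃
      in weaken (≤-trans g≤k+2 (+-monoˡ-≤ 2 (k≤size d₂)))
                (one-unused p₁∈X p₃∈X (dirs-≢ dir-p₁ dir-p₃ λ ()) (unused ¬u₂))
    ... | no ¬u₁ | yes u₂ | yes u₃ =
      let _ , p₂∈X , dir-p₂ = find u₂ ; _ , p₃∈X , dir-p₃ = find u₃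
      in weaken (≤-trans g≤k+2 (+-monoˡ-≤ 2 (k≤size d₁)))
                (one-unused p₂∈X p₃∈X (dirs-≢ dir-p₂ dir-p₃ λ ()) (unused ¬u₁))
    ... | _      | no ¬u₂ | no ¬u₃ =
      weaken (≤-trans g≤k+k (+-mono-≤ (k≤size d₂) (k≤size d₃))) (two-unused (λ ()) (unused ¬u₂) (unused ¬u₃))
    ... | no ¬u₁ | yes _  | no ¬u₃ =
      weaken (≤-trans g≤k+k (+-mono-≤ (k≤size d₁) (k≤size d₃))) (two-unused (λ ()) (unused ¬u₁) (unused ¬u₃))
    ... | no ¬u₁ | no ¬u₂ | yes _  =
      weaken (≤-trans g≤k+k (+-mono-≤ (k≤size d₁) (k≤size d₂))) (two-unused (λ ()) (unused ¬u₁) (unused ¬u₂))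

  upper-bound : ∀ {k g} → (∀ d → k ≤ size d) → g ≤ k + k → g ≤ k + 2 → g ≤ 6 →
    ∀ X → IsTotalMutVis Grid X → length X + g ≤ n₁ + n₂ + n₃
  upper-bound k≤size g≤k+k g≤k+2 g≤6 X (X-unique , vis) =
    Counting.length-bound X-unique (¬Plane vis) k≤size g≤k+k g≤k+2 g≤6

  infixl 8 _[_←_]
  _[_←_] : Vertex → Dir → Vertex → Vertex
  ((_ , b) , c) [ d₁ ← ((a′ , _) , _) ] = (a′ , b) , c
  ((a , _) , c) [ d₂ ← ((_ , b′) , _) ] = (a , b′) , c
  ((a , b) , _) [ d₃ ← ((_ , _) , c′) ] = (a , b) , c′

  step : ∀ d x y → Walk Grid x (x [ d ← y ])
  step d₁ ((a , b) , c) ((a′ , _) , _) =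
    stepAlong (λ i → (i , b) , c) (λ a≢ → inj₁ (inj₁ (a≢ , refl) , refl)) (a ≟ᶠ a′)
  step d₂ ((a , b) , c) ((_ , b′) , _) =
    stepAlong (λ i → (a , i) , c) (λ b≢ → inj₁ (inj₂ (refl , b≢) , refl)) (b ≟ᶠ b′)
  step d₃ ((a , b) , c) ((_ , _) , c′) =
    stepAlong (λ i → (a , b) , i) (λ c≢ → inj₂ (refl , c≢)) (c ≟ᶠ c′)

  dist : Dir → Vertex → Vertex → ℕ
  dist d x y = mismatch (coord d x ≟ᶠ coord d y)

  length-step : ∀ d x y → walkLength Grid (step d x y) ≡ dist d x y
  length-step d₁ _ _ = length-stepAlong _ _ _
  length-step d₂ _ _ = length-stepAlong _ _ _
  length-step d₃ _ _ = length-stepAlong _ _ _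

  All-internal-step : ∀ {P : Vertex → Set} d x y → All P (internal Grid (step d x y))
  All-internal-step d₁ _ _ = All-internal-stepAlong _ _ _
  All-internal-step d₂ _ _ = All-internal-stepAlong _ _ _
  All-internal-step d₃ _ _ = All-internal-stepAlong _ _ _

  hamming : Vertex → Vertex → ℕ
  hamming x y = dist d₁ x y + dist d₂ x y + dist d₃ x y

  hamming-≤-walkLength : ∀ {x y} (w : Walk Grid x y) → hamming x y ≤ walkLength Grid w
  hamming-≤-walkLength {x} {y} w = begin
    hamming x y
      ≤⟨ +-mono-≤ (+-mono-≤ (mismatch-≤-walkLength w₁) (mismatch-≤-walkLength w₂)) (mismatch-≤-walkLength w₃) ⟩
    walkLength (K n₁) w₁ + walkLength (K n₂) w₂ + walkLength (K n₃) w₃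
      ≡⟨ cong (_+ walkLength (K n₃) w₃) (walkLength-□ (projˡ w)) ⟨
    walkLength (K n₁ □ K n₂) (projˡ w) + walkLength (K n₃) w₃
      ≡⟨ walkLength-□ w ⟨
    walkLength Grid w ∎
    where
    open ≤-Reasoning
    w₁ : Walk (K n₁) (coord d₁ x) (coord d₁ y)
    w₁ = projˡ (projˡ w)
    w₂ : Walk (K n₂) (coord d₂ x) (coord d₂ y)
    w₂ = projʳ (projˡ w)
    w₃ : Walk (K n₃) (coord d₃ x) (coord d₃ y)
    w₃ = projʳ w

  stop₁ stop₂ arrival : Route → Vertex → Vertex → Vertex
  stop₁ r x y = x [ first r ← y ]
  stop₂ r x y = stop₁ r x y [ second r ← y ]
  arrival r x y = stop₂ r x y [ third r ← y ]

  arrival≡ : ∀ r x y → arrival r x y ≡ y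
  arrival≡ r₁₂₃ _ _ = refl
  arrival≡ r₁₃₂ _ _ = refl
  arrival≡ r₂₁₃ _ _ = refl
  arrival≡ r₂₃₁ _ _ = refl
  arrival≡ r₃₁₂ _ _ = refl
  arrival≡ r₃₂₁ _ _ = refl

  routeWalk : ∀ r x y → Walk Grid x (arrival r x y)
  routeWalk r x y = step (first r) x y ++ʷ step (second r) (stop₁ r x y) y ++ʷ step (third r) (stop₂ r x y) y

  dist-route : ∀ r x y →
    dist (first r) x y + (dist (second r) (stop₁ r x y) y + dist (third r) (stop₂ r x y) y)
      ≡ hamming x (arrival r x y)
  dist-route r₁₂₃ x y = sum-route r₁₂₃ λ d → dist d x y
  dist-route r₁₃₂ x y = sum-route r₁₃₂ λ d → dist d x y
  dist-route r₂₁₃ x y = sum-route r₂₁₃ λ d → dist d x y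
  dist-route r₂₃₁ x y = sum-route r₂₃₁ λ d → dist d x y
  dist-route r₃₁₂ x y = sum-route r₃₁₂ λ d → dist d x y
  dist-route r₃₂₁ x y = sum-route r₃₂₁ λ d → dist d x y

  length-routeWalk : ∀ r x y → walkLength Grid (routeWalk r x y) ≡ hamming x (arrival r x y)
  length-routeWalk r x y = begin
    walkLength Grid (routeWalk r x y)
      ≡⟨ length-++ʷ (step (first r) x y) _ ⟩
    walkLength Grid (step (first r) x y) + walkLength Grid (step (second r) p y ++ʷ step (third r) q y)
      ≡⟨ cong₂ _+_ (length-step (first r) x y)
                   (trans (length-++ʷ (step (second r) p y) _)
                          (cong₂ _+_ (length-step (second r) p y) (length-step (third r) q y))) ⟩
    dist (first r) x y + (dist (second r) p y + dist (third r) q y)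
      ≡⟨ dist-route r x y ⟩
    hamming x (arrival r x y) ∎
    where
    open ≡-Reasoning
    p q : Vertex
    p = stop₁ r x y
    q = stop₂ r x y

  agrees : Dir → Vertex → Vertex → Bool
  agrees d x y = isYes (coord d x ≟ᶠ coord d y)

  -- A stop is an internal vertex of the route walk unless all steps on one side of it are trivial.
  routeClear : (Vertex → Bool) → Route → Vertex → Vertex → Bool
  routeClear inX r x y =
      (agrees (first r) x y ∨ (agrees (second r) p y ∧ agrees (third r) q y) ∨ not (inX p))
    ∧ (agrees (second r) p y ∨ agrees (third r) q y ∨ not (inX q))
    where
    p q : Vertex
    p = stop₁ r x y
    q = stop₂ r x y

  module _ {X : List Vertex} {inX : Vertex → Bool} (X⊆inX : ∀ {x} → x ∈ X → T (inX x)) where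

    visible-via-route : ∀ r x y → T (routeClear inX r x y) → Visible Grid X x (arrival r x y)
    visible-via-route r x y clear =
      routeWalk r x y ,
      (λ w → subst (_≤ walkLength Grid w) (sym (length-routeWalk r x y)) (hamming-≤-walkLength w)) ,
      All-internal-++ʷ s₁ (s₂ ++ʷ s₃) (All-internal-step _ x y)
        (All-internal-++ʷ s₂ s₃ (All-internal-step _ p y) (All-internal-step _ q y) q-harmless) p-harmless
      where
      p q : Vertex
      p = stop₁ r x y
      q = stop₂ r x y
      s₁ : Walk Grid x p
      s₁ = step (first r) x y
      s₂ : Walk Grid p q
      s₂ = step (second r) p y
      s₃ : Walk Grid q (arrival r x y)
      s₃ = step (third r) q y
      agrees⇒trivial : ∀ {d u} → T (agrees d u y) → walkLength Grid (step d u y) ≡ 0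
      agrees⇒trivial {d} {u} agree = trans (length-step d u y) (mismatch-≡0 (toWitness agree))
      ∉X : ∀ {u} → T (not (inX u)) → u ∉ X
      ∉X ¬inX u∈X = subst T (to T-not-≡ ¬inX) (X⊆inX u∈X)
      p-harmless : p ∉ X ⊎ walkLength Grid s₁ ≡ 0 ⊎ walkLength Grid (s₂ ++ʷ s₃) ≡ 0
      p-harmless with to T-∨ (proj₁ (to T-∧ clear))
      ... | inj₁ agree₁ = inj₂ (inj₁ (agrees⇒trivial {first r} agree₁))
      ... | inj₂ rest with to T-∨ rest
      ...   | inj₂ ¬inX   = inj₁ (∉X ¬inX)
      ...   | inj₁ agree₂₃ = let agree₂ , agree₃ = to T-∧ agree₂₃ in
        inj₂ (inj₂ (trans (length-++ʷ s₂ s₃)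
                          (cong₂ _+_ (agrees⇒trivial {second r} agree₂) (agrees⇒trivial {third r} agree₃))))
      q-harmless : q ∉ X ⊎ walkLength Grid s₂ ≡ 0 ⊎ walkLength Grid s₃ ≡ 0
      q-harmless with to T-∨ (proj₂ (to T-∧ clear))
      ... | inj₁ agree₂ = inj₂ (inj₁ (agrees⇒trivial {second r} agree₂))
      ... | inj₂ rest with to T-∨ rest
      ...   | inj₁ agree₃ = inj₂ (inj₂ (agrees⇒trivial {third r} agree₃))
      ...   | inj₂ ¬inX   = inj₁ (∉X ¬inX)

  inPattern : ClassPattern → Vertex → Bool
  inPattern π x = π (cls (coord d₁ x)) (cls (coord d₂ x)) (cls (coord d₃ x))

  pairAt : Dir → Vertex → Vertex → CoordPair
  pairAt d x y = pairOf (coord d x) (coord d y)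

  routeClear-inPattern : ∀ π r x y →
    routeClear (inPattern π) r x y ≡ routeClearᶜ π r (pairAt d₁ x y) (pairAt d₂ x y) (pairAt d₃ x y)
  routeClear-inPattern π r₁₂₃ _ _ = refl
  routeClear-inPattern π r₁₃₂ _ _ = refl
  routeClear-inPattern π r₂₁₃ _ _ = refl
  routeClear-inPattern π r₂₃₁ _ _ = refl
  routeClear-inPattern π r₃₁₂ _ _ = refl
  routeClear-inPattern π r₃₂₁ _ _ = refl

  Check⇒visible : ∀ {π X} → Check π → All (T ∘ inPattern π) X → ∀ x y → Visible Grid X x y
  Check⇒visible {π} {X} check X⊆π x y =
    let r , _ , clear = find (All.lookup (All.lookup (All.lookup check (∈pairs d₁)) (∈pairs d₂)) (∈pairs d₃))
    in subst (Visible Grid X x) (arrival≡ r x y)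
         (visible-via-route (All.lookup X⊆π) r x y (subst T (sym (routeClear-inPattern π r x y)) clear))
    where
    ∈pairs : ∀ d → pairAt d x y ∈ coordPairs
    ∈pairs d = pairOf∈coordPairs (coord d x) (coord d y)

patternA : ClassPattern
patternA c₁ c₀ c₀ = true
patternA c₂ c₀ c₀ = true
patternA c₀ c₁ c₁ = true
patternA c₀ c₂ c₁ = true
patternA _  _  _  = false

patternB : ClassPattern
patternB c₂ c₀ c₀ = true
patternB c₀ c₂ c₁ = true
patternB c₁ c₁ c₂ = true
patternB _  _  _  = false

checkA : Check patternA
checkA = toWitness {a? = check? patternA} tt

checkB : Check patternB
checkB = toWitness {a? = check? patternB} tt

module Constructions (m₁ m₂ m₃ : ℕ) where

  open Hamming (suc (suc m₁)) (suc (suc m₂)) (suc (suc m₃))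

  blockA₁ : Fin (suc m₁) → Vertex
  blockA₁ i = (suc i , zero) , zero

  blockA₂ : Fin (suc m₂) → Vertex
  blockA₂ j = (zero , suc j) , suc zero

  XA : List Vertex
  XA = tabulate blockA₁ ++ tabulate blockA₂

  XA-tmv : IsTotalMutVis Grid XA
  XA-tmv = ++⁺ (tabulate⁺ {f = blockA₁} λ { refl → refl }) (tabulate⁺ {f = blockA₂} λ { refl → refl })
               disjoint ,
           Check⇒visible {patternA} checkA
             (All.++⁺ (All.tabulate⁺ {f = blockA₁} λ { zero → tt ; (suc _) → tt })
                      (All.tabulate⁺ {f = blockA₂} λ { zero → tt ; (suc _) → tt }))
    where
    disjoint : ∀ {x} → ¬ (x ∈ tabulate blockA₁ × x ∈ tabulate blockA₂)
    disjoint (x∈₁ , x∈₂) with ∈-tabulate⁻ {f = blockA₁} x∈₁ | ∈-tabulate⁻ {f = blockA₂} x∈₂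
    ... | _ , refl | _ , ()

  length-XA : length XA ≡ suc m₁ + suc m₂
  length-XA = trans (length-++ (tabulate blockA₁)) (cong₂ _+_ (length-tabulate blockA₁) (length-tabulate blockA₂))

  blockB₁ : Fin m₁ → Vertex
  blockB₁ i = (suc (suc i) , zero) , zero

  blockB₂ : Fin m₂ → Vertex
  blockB₂ j = (zero , suc (suc j)) , suc zero

  blockB₃ : Fin m₃ → Vertex
  blockB₃ k = (suc zero , suc zero) , suc (suc k)

  XB : List Vertex
  XB = (tabulate blockB₁ ++ tabulate blockB₂) ++ tabulate blockB₃

  XB-tmv : IsTotalMutVis Grid XB
  XB-tmv = ++⁺ (++⁺ (tabulate⁺ {f = blockB₁} λ { refl → refl }) (tabulate⁺ {f = blockB₂} λ { refl → refl })
                    disjoint₁₂)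
               (tabulate⁺ {f = blockB₃} λ { refl → refl }) disjoint₁₂-₃ ,
           Check⇒visible {patternB} checkB
             (All.++⁺ (All.++⁺ (All.tabulate⁺ {f = blockB₁} λ _ → tt) (All.tabulate⁺ {f = blockB₂} λ _ → tt))
                      (All.tabulate⁺ {f = blockB₃} λ _ → tt))
    where
    disjoint₁₂ : ∀ {x} → ¬ (x ∈ tabulate blockB₁ × x ∈ tabulate blockB₂)
    disjoint₁₂ (x∈₁ , x∈₂) with ∈-tabulate⁻ {f = blockB₁} x∈₁ | ∈-tabulate⁻ {f = blockB₂} x∈₂
    ... | _ , refl | _ , ()
    disjoint₁₂-₃ : ∀ {x} → ¬ (x ∈ tabulate blockB₁ ++ tabulate blockB₂ × x ∈ tabulate blockB₃)
    disjoint₁₂-₃ (x∈₁₂ , x∈₃) with ∈-++⁻ (tabulate blockB₁) x∈₁₂ | ∈-tabulate⁻ {f = blockB₃} x∈₃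
    ... | inj₁ x∈₁ | _ , refl with ∈-tabulate⁻ {f = blockB₁} x∈₁
    ...   | _ , ()
    disjoint₁₂-₃ (x∈₁₂ , x∈₃) | inj₂ x∈₂ | _ , refl with ∈-tabulate⁻ {f = blockB₂} x∈₂
    ...   | _ , ()

  length-XB : length XB ≡ m₁ + m₂ + m₃
  length-XB = trans (length-++ (tabulate blockB₁ ++ tabulate blockB₂))
    (cong₂ _+_ (trans (length-++ (tabulate blockB₁))
                      (cong₂ _+_ (length-tabulate blockB₁) (length-tabulate blockB₂)))
               (length-tabulate blockB₃))

theorem1p1 : ∀ (n₁ n₂ n₃ : ℕ) → n₂ ≤ n₁ → n₃ ≤ n₂ → 2 ≤ n₃ →
    (n₃ ≡ 2 → IsMuT (K n₁ □ K n₂ □ K n₃) (n₁ + n₂ + n₃ ∸ 4))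
    × (n₃ ≡ 3 → IsMuT (K n₁ □ K n₂ □ K n₃) (n₁ + n₂ + n₃ ∸ 5))
    × (4 ≤ n₃ → IsMuT (K n₁ □ K n₂ □ K n₃) (n₁ + n₂ + n₃ ∸ 6))
theorem1p1 (suc (suc m₁)) (suc (suc m₂)) (suc (suc m₃))
           n₂≤n₁@(s≤s (s≤s _)) n₃≤n₂@(s≤s (s≤s _)) (s≤s (s≤s _)) =
  (λ { refl → IsMuT-∸ XA-tmv (trans (cong (_+ 4) length-XA) (count₂ m₁ m₂))
                (upper-bound n₃≤size ≤-refl ≤-refl (m≤m+n 4 2)) }) ,
  (λ { refl → IsMuT-∸ XA-tmv (trans (cong (_+ 5) length-XA) (count₃ m₁ m₂))
                (upper-bound n₃≤size (m≤m+n 5 1) ≤-refl (m≤m+n 5 1)) }) ,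
  λ 4≤n₃ → IsMuT-∸ XB-tmv (trans (cong (_+ 6) length-XB) (count₄ m₁ m₂ m₃))
             (upper-bound n₃≤size (≤-trans (m≤m+n 6 2) (+-mono-≤ 4≤n₃ 4≤n₃)) (+-monoˡ-≤ 2 4≤n₃) ≤-refl)
  where
  open Hamming (suc (suc m₁)) (suc (suc m₂)) (suc (suc m₃))
  open Constructions m₁ m₂ m₃
  n₃≤size : ∀ d → suc (suc m₃) ≤ size d
  n₃≤size d₁ = ≤-trans n₃≤n₂ n₂≤n₁
  n₃≤size d₂ = n₃≤n₂
  n₃≤size d₃ = ≤-refl
  count₂ : ∀ a b → suc a + suc b + 4 ≡ suc (suc a) + suc (suc b) + 2
  count₂ = solve-∀
  count₃ : ∀ a b → suc a + suc b + 5 ≡ suc (suc a) + suc (suc b) + 3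
  count₃ = solve-∀
  count₄ : ∀ a b c → a + b + c + 6 ≡ suc (suc a) + suc (suc b) + suc (suc c)
  count₄ = solve-∀
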